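{- For every $p\in\mathbb{N}^\mathbb{N}$, $\operatorname{id}\restriction_{\{p\}}$ is a strong minimal cover of $\operatorname{id}\restriction_{\mathrm{Succ}(p)}$ in the Weihrauch degrees.
   Context: A partial multi-valued function $f$ on Baire space assigns to each $x\in\operatorname{dom}(f)\subseteq\mathbb{N}^\mathbb{N}$ a nonempty set $f(x)\subseteq\mathbb{N}^\mathbb{N}$. $f\le_{\mathrm{W}} g$ (Weihrauch reducibility) means there are partial computable functionals $\Phi,\Psi$ such that for every $p\in\operatorname{dom}(f)$, $\Phi(p)\in\operatorname{dom}(g)$ and for every $q\in g(\Phi(p))$, $\Psi(p,q)\in f(p)$. $f$ is a strong minimal cover of $h$ if $h<_{\mathrm{W}} f$ and every $c$ with $c<_{\mathrm{W}} f$ satisfies $c\le_{\mathrm{W}} h$. For $X\subseteq\mathbb{N}^\mathbb{N}$, $\operatorname{id}\restriction_X$ is the identity on Baire space restricted to $X$. Letting $(\Phi_e)_e$ be a standard enumeration of partial computable functionals, $\mathrm{Succ}(p):=\{\langle e\rangle^\frown q : \Phi_e(q)=p \text{ and } q\not\le_\mathrm{T} p\}$. -}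

module Defs where

open import Data.Nat using (ℕ; zero; suc; _+_; _*_; _^_; _<_)
open import Data.Fin using (Fin; toℕ)
open import Data.Vec using (Vec; []; _∷_)
open import Data.Product using (Σ; ∃; _×_; _,_)
open import Relation.Nullary using (¬_)
open import Relation.Binary.PropositionalEquality using (_≡_)
open import Level using (0ℓ)
open import Axiom.ExcludedMiddle using (ExcludedMiddle)

Baire : Set
Baire = ℕ → ℕ

_≈B_ : Baire → Baire → Set
x ≈B y = ∀ n → x n ≡ y n

-- Partial recursive functions relative to an oracle (Kleene's mu-recursive
-- basis plus an oracle-query function), as codes indexed by arity.

data Code : ℕ → Set where
  zer  : ∀ {n} → Code n
  sucC : Code 1
  prj  : ∀ {n} → Fin n → Code n
  orc  : Code 1
  comp : ∀ {m n} → Code m → Vec (Code n) m → Code n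
  prec : ∀ {n} → Code n → Code (suc (suc n)) → Code (suc n)
  mu   : ∀ {n} → Code (suc n) → Code n

lookupV : ∀ {n} → Vec ℕ n → Fin n → ℕ
lookupV (x ∷ xs) Fin.zero = x
lookupV (x ∷ xs) (Fin.suc i) = lookupV xs i

mutual
  data Eval (α : Baire) : ∀ {n} → Code n → Vec ℕ n → ℕ → Set where
    ev-zer  : ∀ {n} {xs : Vec ℕ n} → Eval α zer xs 0
    ev-suc  : ∀ {x} → Eval α sucC (x ∷ []) (suc x)
    ev-prj  : ∀ {n} {i : Fin n} {xs} → Eval α (prj i) xs (lookupV xs i)
    ev-orc  : ∀ {x} → Eval α orc (x ∷ []) (α x)
    ev-comp : ∀ {m n} {f : Code m} {gs : Vec (Code n) m} {xs ys y} →
              EvalV α gs xs ys → Eval α f ys y → Eval α (comp f gs) xs y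
    ev-prec0 : ∀ {n} {f : Code n} {g : Code (suc (suc n))} {xs y} →
               Eval α f xs y → Eval α (prec f g) (0 ∷ xs) y
    ev-precS : ∀ {n} {f : Code n} {g : Code (suc (suc n))} {k xs z y} →
               Eval α (prec f g) (k ∷ xs) z → Eval α g (k ∷ z ∷ xs) y →
               Eval α (prec f g) (suc k ∷ xs) y
    ev-mu   : ∀ {n} {f : Code (suc n)} {xs k} →
              Eval α f (k ∷ xs) 0 →
              (∀ m → m < k → ∃ λ j → Eval α f (m ∷ xs) (suc j)) →
              Eval α (mu f) xs k

  data EvalV (α : Baire) {n} : ∀ {m} → Vec (Code n) m → Vec ℕ n → Vec ℕ m → Set where
    evv-[] : ∀ {xs} → EvalV α [] xs []
    evv-∷  : ∀ {m} {g : Code n} {gs : Vec (Code n) m} {xs y ys} →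
             Eval α g xs y → EvalV α gs xs ys → EvalV α (g ∷ gs) xs (y ∷ ys)

-- Partial computable functionals on Baire space: index e : Code 1,
-- Φ_e(q) = p  iff  for all n, the code e with oracle q on input n halts with p n.

Functional : Set
Functional = Code 1

_⟦_⟧≡_ : Functional → Baire → Baire → Set
e ⟦ q ⟧≡ p = ∀ n → Eval q e (n ∷ []) (p n)

_≤T_ : Baire → Baire → Set
q ≤T p = Σ Functional λ e → e ⟦ p ⟧≡ q

-- Gödel numbering of codes (injective, computably invertible),
-- via the pairing ⟨a , b⟩ = 2^a * (2b+1).
⟨_,_⟩ : ℕ → ℕ → ℕ
⟨ a , b ⟩ = (2 ^ a) * (suc (2 * b))

mutual
  ⌜_⌝ : ∀ {n} → Code n → ℕ
  ⌜_⌝ {n} zer = ⟨ 0 , n ⟩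
  ⌜ sucC ⌝ = ⟨ 1 , 0 ⟩
  ⌜_⌝ {n} (prj i) = ⟨ 2 , ⟨ n , toℕ i ⟩ ⟩
  ⌜ orc ⌝ = ⟨ 3 , 0 ⟩
  ⌜ comp f gs ⌝ = ⟨ 4 , ⟨ ⌜ f ⌝ , ⌜ gs ⌝V ⟩ ⟩
  ⌜ prec f g ⌝ = ⟨ 5 , ⟨ ⌜ f ⌝ , ⌜ g ⌝ ⟩ ⟩
  ⌜ mu f ⌝ = ⟨ 6 , ⌜ f ⌝ ⟩

  ⌜_⌝V : ∀ {n m} → Vec (Code n) m → ℕ
  ⌜ [] ⌝V = 0
  ⌜ g ∷ gs ⌝V = suc ⟨ ⌜ g ⌝ , ⌜ gs ⌝V ⟩

record MVF : Set₁ where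
  field
    dom      : Baire → Set
    val      : Baire → Baire → Set
    nonempty : ∀ x → dom x → ∃ λ y → val x y
open MVF public

-- join of two oracles: (p ⊕ q)(2n) = p n, (p ⊕ q)(2n+1) = q n
_⊕_ : Baire → Baire → Baire
(p ⊕ q) zero = p 0
(p ⊕ q) (suc zero) = q 0
(p ⊕ q) (suc (suc n)) = ((λ k → p (suc k)) ⊕ (λ k → q (suc k))) n

_≤W_ : MVF → MVF → Set
f ≤W g = Σ Functional λ Φ → Σ Functional λ Ψ →
  ∀ p → dom f p →
    ∃ λ r → Φ ⟦ p ⟧≡ r × dom g r ×
      (∀ q → val g r q → ∃ λ s → Ψ ⟦ p ⊕ q ⟧≡ s × val f p s)

_<W_ : MVF → MVF → Set
f <W g = f ≤W g × ¬ (g ≤W f)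

StrongMinimalCover : MVF → MVF → Set₁
StrongMinimalCover f h = h <W f × (∀ c → c <W f → c ≤W h)

idOn : (Baire → Set) → MVF
idOn X = record { dom = X ; val = λ x y → y ≈B x ; nonempty = λ x _ → x , λ n → Relation.Binary.PropositionalEquality.refl }

Singleton : Baire → Baire → Set
Singleton p x = x ≈B p

_⌢_ : ℕ → Baire → Baire
(e ⌢ q) zero = e
(e ⌢ q) (suc n) = q n

Succ : Baire → Baire → Set
Succ p x = Σ Functional λ e → Σ Baire λ q →
  x ≈B (⌜ e ⌝ ⌢ q) × e ⟦ q ⟧≡ p × ¬ (q ≤T p)

LEM : Set₁
LEM = ExcludedMiddle 0ℓ

{-# OPTIONS --safe #-}
module Submission where

-- Strictness: if id↾{p} ≤W id↾Succ(p) via Φ, then Φ(p) = ⌜ e ⌝ ⌢ q ∈ Succ(p), yet q, the tail of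
-- Φ(p), is computable from p. Strong minimality: if c <W id↾{p} via (Φ, Ψ), then Φ(x) = p for every
-- x ∈ dom c, and x ≰T p, for otherwise id↾{p} ≤W c; so x ↦ ⌜ Φ ⌝ ⌢ x maps dom c into Succ(p), and
-- Ψ still applies since Φ(x) can be recomputed from x. The real work is id↾Succ(p) ≤W id↾{p}, which
-- must compute p = Φ_e(q) uniformly from ⌜ e ⌝ ⌢ q: a universal functional. It iterates the
-- primitive recursive transition function of a stack machine for codes, and a single unbounded
-- search finds the first halting configuration.

open import Defs
open import Data.Nat using (ℕ; zero; suc; pred; _+_; _*_; _∸_; _^_; _≤_; _<_; z≤n; s≤s; _≟_; ≢-nonZero)
open import Data.Nat.Properties
open import Data.Nat.GeneralisedArithmetic using (fold; fold-+)
open import Data.Fin using (Fin; #_; toℕ) renaming (zero to fz; suc to fs)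
open import Data.Vec using (Vec; []; _∷_; head; tail; tabulate)
open import Data.Product
open import Data.Sum using (_⊎_; inj₁; inj₂)
open import Function using (_∘′_; _∘_)
open import Relation.Binary.PropositionalEquality
open import Relation.Binary.Construct.Closure.ReflexiveTransitive using (Star; ε; _◅_; _◅◅_)
open import Relation.Nullary
open import Relation.Unary using (Decidable)
open ≡-Reasoning

data Prog : ℕ → Set where
  zeroᴾ   : ∀ {n} → Prog n
  sucᴾ    : Prog 1
  var     : ∀ {n} → Fin n → Prog n
  oracleᴾ : Prog 1
  compᴾ   : ∀ {m n} → Prog m → Vec (Prog n) m → Prog n
  recᴾ    : ∀ {n} → Prog n → Prog (suc (suc n)) → Prog (suc n)
  embed   : ∀ {n} (c : Code n) (f : Baire → Vec ℕ n → ℕ) →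
            (∀ α xs → Eval α c xs (f α xs)) → Prog n

mutual
  ⟦_⟧ : ∀ {n} → Prog n → Baire → Vec ℕ n → ℕ
  ⟦ zeroᴾ ⟧       α xs       = 0
  ⟦ sucᴾ ⟧        α (x ∷ []) = suc x
  ⟦ var i ⟧       α xs       = lookupV xs i
  ⟦ oracleᴾ ⟧     α (x ∷ []) = α x
  ⟦ compᴾ f gs ⟧  α xs       = ⟦ f ⟧ α (⟦ gs ⟧* α xs)
  ⟦ recᴾ f g ⟧    α (k ∷ xs) = ⟦rec⟧ f g α k xs
  ⟦ embed _ f _ ⟧ α xs       = f α xs

  ⟦rec⟧ : ∀ {n} → Prog n → Prog (suc (suc n)) → Baire → ℕ → Vec ℕ n → ℕ
  ⟦rec⟧ f g α zero    xs = ⟦ f ⟧ α xs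
  ⟦rec⟧ f g α (suc k) xs = ⟦ g ⟧ α (k ∷ ⟦rec⟧ f g α k xs ∷ xs)

  ⟦_⟧* : ∀ {n m} → Vec (Prog n) m → Baire → Vec ℕ n → Vec ℕ m
  ⟦ [] ⟧*     α xs = []
  ⟦ g ∷ gs ⟧* α xs = ⟦ g ⟧ α xs ∷ ⟦ gs ⟧* α xs

mutual
  compile : ∀ {n} → Prog n → Code n
  compile zeroᴾ         = zer
  compile sucᴾ          = sucC
  compile (var i)       = prj i
  compile oracleᴾ       = orc
  compile (compᴾ f gs)  = comp (compile f) (compile* gs)
  compile (recᴾ f g)    = prec (compile f) (compile g)
  compile (embed c _ _) = c

  compile* : ∀ {n m} → Vec (Prog n) m → Vec (Code n) m
  compile* []       = []
  compile* (g ∷ gs) = compile g ∷ compile* gs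

mutual
  compile-correct : ∀ {n} (P : Prog n) α xs → Eval α (compile P) xs (⟦ P ⟧ α xs)
  compile-correct zeroᴾ          α xs       = ev-zer
  compile-correct sucᴾ           α (x ∷ []) = ev-suc
  compile-correct (var i)        α xs       = ev-prj
  compile-correct oracleᴾ        α (x ∷ []) = ev-orc
  compile-correct (compᴾ f gs)   α xs       = ev-comp (compile*-correct gs α xs) (compile-correct f α _)
  compile-correct (recᴾ f g)     α (k ∷ xs) = compile-rec-correct f g α k xs
  compile-correct (embed _ _ ok) α xs       = ok α xs

  compile-rec-correct : ∀ {n} (f : Prog n) (g : Prog (suc (suc n))) α k xs →
                        Eval α (prec (compile f) (compile g)) (k ∷ xs) (⟦rec⟧ f g α k xs)
  compile-rec-correct f g α zero    xs = ev-prec0 (compile-correct f α xs)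
  compile-rec-correct f g α (suc k) xs = ev-precS (compile-rec-correct f g α k xs) (compile-correct g α _)

  compile*-correct : ∀ {n m} (gs : Vec (Prog n) m) α xs → EvalV α (compile* gs) xs (⟦ gs ⟧* α xs)
  compile*-correct []       α xs = evv-[]
  compile*-correct (g ∷ gs) α xs = evv-∷ (compile-correct g α xs) (compile*-correct gs α xs)

compile-computes : ∀ {n} (P : Prog n) {α xs y} → ⟦ P ⟧ α xs ≡ y → Eval α (compile P) xs y
compile-computes P {α} {xs} refl = compile-correct P α xs

⟦_⟧₁ : Prog 1 → Baire → ℕ → ℕ
⟦ P ⟧₁ α x = ⟦ P ⟧ α (x ∷ [])

call₁ : ∀ {n} → Prog 1 → Prog n → Prog n
call₁ f a = compᴾ f (a ∷ [])

call₂ : ∀ {n} → Prog 2 → Prog n → Prog n → Prog n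
call₂ f a b = compᴾ f (a ∷ b ∷ [])

call₃ : ∀ {n} → Prog 3 → Prog n → Prog n → Prog n → Prog n
call₃ f a b c = compᴾ f (a ∷ b ∷ c ∷ [])

oneᴾ : ∀ {n} → Prog n
oneᴾ = call₁ sucᴾ zeroᴾ

predᴾ : Prog 1
predᴾ = recᴾ zeroᴾ (var (# 0))

ifZeroᴾ : Prog 3
ifZeroᴾ = recᴾ (var (# 0)) (var (# 3))

addᴾ : Prog 2
addᴾ = recᴾ (var (# 0)) (call₁ sucᴾ (var (# 1)))

doubleᴾ : Prog 1
doubleᴾ = recᴾ zeroᴾ (call₁ sucᴾ (call₁ sucᴾ (var (# 1))))

mulᴾ : Prog 2
mulᴾ = recᴾ zeroᴾ (call₂ addᴾ (var (# 1)) (var (# 2)))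

pow2ᴾ : Prog 1
pow2ᴾ = recᴾ oneᴾ (call₁ doubleᴾ (var (# 1)))

pairᴾ : Prog 2
pairᴾ = call₂ mulᴾ (call₁ pow2ᴾ (var (# 0))) (call₁ sucᴾ (call₁ doubleᴾ (var (# 1))))

parityᴾ : Prog 1
parityᴾ = recᴾ zeroᴾ (call₃ ifZeroᴾ (var (# 1)) oneᴾ zeroᴾ)

halfᴾ : Prog 1
halfᴾ = recᴾ zeroᴾ (call₂ addᴾ (var (# 1)) (call₁ parityᴾ (var (# 0))))

halveIfEvenᴾ : Prog 1
halveIfEvenᴾ = call₃ ifZeroᴾ (call₁ parityᴾ (var (# 0))) (call₁ halfᴾ (var (# 0))) (var (# 0))

iterateHalveᴾ : Prog 2
iterateHalveᴾ = recᴾ (var (# 0)) (call₁ halveIfEvenᴾ (var (# 1)))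

isEvenᴾ : Prog 1
isEvenᴾ = call₃ ifZeroᴾ (call₁ parityᴾ (var (# 0))) oneᴾ zeroᴾ

countEvenHalvingsᴾ : Prog 2
countEvenHalvingsᴾ =
  recᴾ zeroᴾ (call₂ addᴾ (var (# 1)) (call₁ isEvenᴾ (call₂ iterateHalveᴾ (var (# 0)) (var (# 2)))))

-- Halving ⟨ a , b ⟩ = 2 ^ a * (2b + 1) while it is even, ⟨ a , b ⟩ times (a < ⟨ a , b ⟩), leaves
-- 2b + 1, and a is the number of those steps that met an even number.
fstᴾ : Prog 1
fstᴾ = call₂ countEvenHalvingsᴾ (var (# 0)) (var (# 0))

sndᴾ : Prog 1
sndᴾ = call₁ halfᴾ (call₂ iterateHalveᴾ (var (# 0)) (var (# 0)))

n<2^n : ∀ n → n < 2 ^ n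
n<2^n zero    = s≤s z≤n
n<2^n (suc n) = +-mono-≤ (m^n>0 2 n) (≤-trans (n<2^n n) (m≤m+n (2 ^ n) 0))

module _ (α : Baire) where
  private
    double half parity halveIfEven isEven : ℕ → ℕ
    double      = ⟦ doubleᴾ ⟧₁ α
    half        = ⟦ halfᴾ ⟧₁ α
    parity      = ⟦ parityᴾ ⟧₁ α
    halveIfEven = ⟦ halveIfEvenᴾ ⟧₁ α
    isEven      = ⟦ isEvenᴾ ⟧₁ α

    iterateHalve countEvenHalvings : ℕ → ℕ → ℕ
    iterateHalve k m      = ⟦ iterateHalveᴾ ⟧ α (k ∷ m ∷ [])
    countEvenHalvings k m = ⟦ countEvenHalvingsᴾ ⟧ α (k ∷ m ∷ [])

  addᴾ-correct : ∀ a b → ⟦ addᴾ ⟧ α (a ∷ b ∷ []) ≡ a + b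
  addᴾ-correct zero    b = refl
  addᴾ-correct (suc a) b = cong suc (addᴾ-correct a b)

  doubleᴾ-correct : ∀ a → ⟦ doubleᴾ ⟧₁ α a ≡ 2 * a
  doubleᴾ-correct zero    = refl
  doubleᴾ-correct (suc a) = trans (cong (2 +_) (doubleᴾ-correct a)) (sym (*-suc 2 a))

  mulᴾ-correct : ∀ a b → ⟦ mulᴾ ⟧ α (a ∷ b ∷ []) ≡ a * b
  mulᴾ-correct zero    b = refl
  mulᴾ-correct (suc a) b = begin
    ⟦ addᴾ ⟧ α (⟦ mulᴾ ⟧ α (a ∷ b ∷ []) ∷ b ∷ []) ≡⟨ addᴾ-correct _ b ⟩
    ⟦ mulᴾ ⟧ α (a ∷ b ∷ []) + b                    ≡⟨ cong (_+ b) (mulᴾ-correct a b) ⟩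
    a * b + b                                       ≡⟨ +-comm (a * b) b ⟩
    b + a * b                                       ∎

  pow2ᴾ-correct : ∀ a → ⟦ pow2ᴾ ⟧₁ α a ≡ 2 ^ a
  pow2ᴾ-correct zero    = refl
  pow2ᴾ-correct (suc a) = trans (doubleᴾ-correct (⟦ pow2ᴾ ⟧₁ α a)) (cong (2 *_) (pow2ᴾ-correct a))

  pairᴾ-correct : ∀ a b → ⟦ pairᴾ ⟧ α (a ∷ b ∷ []) ≡ ⟨ a , b ⟩
  pairᴾ-correct a b = trans (mulᴾ-correct (⟦ pow2ᴾ ⟧₁ α a) (suc (⟦ doubleᴾ ⟧₁ α b)))
    (cong₂ _*_ (pow2ᴾ-correct a) (cong suc (doubleᴾ-correct b)))

  parity-even : ∀ x → parity (double x) ≡ 0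
  parity-even zero = refl
  parity-even (suc x) rewrite parity-even x = refl

  parity-odd : ∀ x → parity (suc (double x)) ≡ 1
  parity-odd x rewrite parity-even x = refl

  private
    half-suc : ∀ n → half (suc n) ≡ half n + parity n
    half-suc n = addᴾ-correct (half n) (parity n)

  mutual
    half-even : ∀ x → half (double x) ≡ x
    half-even zero    = refl
    half-even (suc x) = begin
      half (suc (suc (double x)))                    ≡⟨ half-suc (suc (double x)) ⟩
      half (suc (double x)) + parity (suc (double x)) ≡⟨ cong₂ _+_ (half-odd x) (parity-odd x) ⟩
      x + 1                                          ≡⟨ +-comm x 1 ⟩
      suc x                                          ∎

    half-odd : ∀ x → half (suc (double x)) ≡ x
    half-odd x = begin
      half (suc (double x))           ≡⟨ half-suc (double x) ⟩
      half (double x) + parity (double x) ≡⟨ cong₂ _+_ (half-even x) (parity-even x) ⟩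
      x + 0                           ≡⟨ +-identityʳ x ⟩
      x                               ∎

  private
    halveIfEven-even : ∀ x → halveIfEven (double x) ≡ x
    halveIfEven-even x rewrite parity-even x = half-even x

    halveIfEven-odd : ∀ x → halveIfEven (suc (double x)) ≡ suc (double x)
    halveIfEven-odd x rewrite parity-odd x = refl

    2^suc*-double : ∀ d o → 2 ^ suc d * o ≡ double (2 ^ d * o)
    2^suc*-double d o = trans (*-assoc 2 (2 ^ d) o) (sym (doubleᴾ-correct (2 ^ d * o)))

  module _ (b : ℕ) where
    private
      odd : ℕ
      odd = suc (double b)

      halveIfEven-2^* : ∀ d → halveIfEven (2 ^ d * odd) ≡ 2 ^ pred d * odd
      halveIfEven-2^* zero rewrite +-identityʳ (double b) = halveIfEven-odd b
      halveIfEven-2^* (suc d) rewrite 2^suc*-double d odd = halveIfEven-even (2 ^ d * odd)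

      isEven-2^* : ∀ d → isEven (2 ^ d * odd) + pred d ≡ d
      isEven-2^* zero rewrite +-identityʳ (double b) | parity-odd b = refl
      isEven-2^* (suc d) rewrite 2^suc*-double d odd | parity-even (2 ^ d * odd) = refl

    iterateHalve-2^* : ∀ a k → iterateHalve k (2 ^ a * odd) ≡ 2 ^ (a ∸ k) * odd
    iterateHalve-2^* a zero    = refl
    iterateHalve-2^* a (suc k) = begin
      halveIfEven (iterateHalve k (2 ^ a * odd)) ≡⟨ cong halveIfEven (iterateHalve-2^* a k) ⟩
      halveIfEven (2 ^ (a ∸ k) * odd)            ≡⟨ halveIfEven-2^* (a ∸ k) ⟩
      2 ^ pred (a ∸ k) * odd                     ≡⟨ cong (λ d → 2 ^ d * odd) (pred[m∸n]≡m∸[1+n] a k) ⟩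
      2 ^ (a ∸ suc k) * odd                      ∎

    countEvenHalvings-2^* : ∀ a k → countEvenHalvings k (2 ^ a * odd) + (a ∸ k) ≡ a
    countEvenHalvings-2^* a zero    = refl
    countEvenHalvings-2^* a (suc k) = begin
      ⟦ addᴾ ⟧ α (c ∷ e ∷ []) + (a ∸ suc k)   ≡⟨ cong (_+ (a ∸ suc k)) (addᴾ-correct c e) ⟩
      c + e + (a ∸ suc k)                     ≡⟨ +-assoc c e (a ∸ suc k) ⟩
      c + (e + (a ∸ suc k))                   ≡⟨ cong (λ d → c + (e + d)) (sym (pred[m∸n]≡m∸[1+n] a k)) ⟩
      c + (e + pred (a ∸ k))                  ≡⟨ cong (λ m → c + (isEven m + pred (a ∸ k))) (iterateHalve-2^* a k) ⟩
      c + (isEven (2 ^ (a ∸ k) * odd) + pred (a ∸ k)) ≡⟨ cong (c +_) (isEven-2^* (a ∸ k)) ⟩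
      c + (a ∸ k)                             ≡⟨ countEvenHalvings-2^* a k ⟩
      a                                       ∎
      where
      c = countEvenHalvings k (2 ^ a * odd)
      e = isEven (iterateHalve k (2 ^ a * odd))

  private
    fst≤⟨⟩ : ∀ a b → a ≤ ⟨ a , b ⟩
    fst≤⟨⟩ a b = ≤-trans (<⇒≤ (n<2^n a)) (m≤m*n (2 ^ a) (suc (2 * b)))

    ⟨⟩-as-2^* : ∀ a b → ⟨ a , b ⟩ ≡ 2 ^ a * suc (double b)
    ⟨⟩-as-2^* a b = cong (λ d → 2 ^ a * suc d) (sym (doubleᴾ-correct b))

  fstᴾ-correct : ∀ a b → ⟦ fstᴾ ⟧₁ α ⟨ a , b ⟩ ≡ a
  fstᴾ-correct a b = begin
    countEvenHalvings c c                   ≡⟨ sym (+-identityʳ _) ⟩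
    countEvenHalvings c c + 0               ≡⟨ cong (countEvenHalvings c c +_) (sym (m≤n⇒m∸n≡0 (fst≤⟨⟩ a b))) ⟩
    countEvenHalvings c c + (a ∸ c)         ≡⟨ cong (λ m → countEvenHalvings c m + (a ∸ c)) (⟨⟩-as-2^* a b) ⟩
    countEvenHalvings c (2 ^ a * suc (double b)) + (a ∸ c) ≡⟨ countEvenHalvings-2^* b a c ⟩
    a                                       ∎
    where c = ⟨ a , b ⟩

  sndᴾ-correct : ∀ a b → ⟦ sndᴾ ⟧₁ α ⟨ a , b ⟩ ≡ b
  sndᴾ-correct a b = begin
    half (iterateHalve c c)                        ≡⟨ cong (half ∘′ iterateHalve c) (⟨⟩-as-2^* a b) ⟩
    half (iterateHalve c (2 ^ a * suc (double b))) ≡⟨ cong half (iterateHalve-2^* b a c) ⟩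
    half (2 ^ (a ∸ c) * suc (double b))            ≡⟨ cong (λ d → half (2 ^ d * suc (double b))) (m≤n⇒m∸n≡0 (fst≤⟨⟩ a b)) ⟩
    half (suc (double b) + 0)                      ≡⟨ cong half (+-identityʳ (suc (double b))) ⟩
    half (suc (double b))                          ≡⟨ half-odd b ⟩
    b                                              ∎
    where c = ⟨ a , b ⟩

-- Opaque, so that normalising the transition program of the machine below never unfolds the
-- unpairing programs; they enter that program through `embed`.
opaque
  fstℕ sndℕ : Baire → ℕ → ℕ
  fstℕ = ⟦ fstᴾ ⟧₁
  sndℕ = ⟦ sndᴾ ⟧₁

  fstℕ-⟨,⟩ : ∀ α a b → fstℕ α ⟨ a , b ⟩ ≡ a
  fstℕ-⟨,⟩ = fstᴾ-correct

  sndℕ-⟨,⟩ : ∀ α a b → sndℕ α ⟨ a , b ⟩ ≡ b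
  sndℕ-⟨,⟩ = sndᴾ-correct

  fstᴾ-evaluates : ∀ α xs → Eval α (compile fstᴾ) xs (fstℕ α (head xs))
  fstᴾ-evaluates α (v ∷ []) = compile-correct fstᴾ α (v ∷ [])

  sndᴾ-evaluates : ∀ α xs → Eval α (compile sndᴾ) xs (sndℕ α (head xs))
  sndᴾ-evaluates α (v ∷ []) = compile-correct sndᴾ α (v ∷ [])

pairᴾ-evaluates : ∀ α xs → Eval α (compile pairᴾ) xs ⟨ head xs , head (tail xs) ⟩
pairᴾ-evaluates α (a ∷ b ∷ []) = compile-computes pairᴾ (pairᴾ-correct α a b)

fstE sndE predE headE tailE : ∀ {n} → Prog n → Prog n
fstE  = call₁ (embed (compile fstᴾ) (λ α → fstℕ α ∘′ head) fstᴾ-evaluates)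
sndE  = call₁ (embed (compile sndᴾ) (λ α → sndℕ α ∘′ head) sndᴾ-evaluates)
predE = call₁ predᴾ
headE = fstE ∘′ predE
tailE = sndE ∘′ predE

pairE consE : ∀ {n} → Prog n → Prog n → Prog n
pairE     = call₂ (embed (compile pairᴾ) (λ α xs → ⟨ head xs , head (tail xs) ⟩) pairᴾ-evaluates)
consE a b = call₁ sucᴾ (pairE a b)

ifZeroE : ∀ {n} → Prog n → Prog n → Prog n → Prog n
ifZeroE = call₃ ifZeroᴾ

litE : ∀ {n} → ℕ → Prog n
litE zero    = zeroᴾ
litE (suc k) = call₁ sucᴾ (litE k)

unpairIn : ∀ {n} → Prog n → Prog (suc (suc n)) → Prog n
unpairIn e body = compᴾ body (fstE e ∷ sndE e ∷ tabulate var)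

caseE : ∀ {n m} → Prog n → Vec (Prog n) m → Prog n → Prog n
caseE t []       default = default
caseE t (b ∷ bs) default = ifZeroE t b (caseE (predE t) bs default)

encodeVec : ∀ {n} → Vec ℕ n → ℕ
encodeVec []       = 0
encodeVec (x ∷ xs) = suc ⟨ x , encodeVec xs ⟩

dropᴾ : Prog 2
dropᴾ = recᴾ (var (# 0)) (tailE (var (# 1)))

lookupᴾ : Prog 2
lookupᴾ = headE (call₂ dropᴾ (var (# 0)) (var (# 1)))

module _ (α : Baire) where
  private
    drop : ℕ → ℕ → ℕ
    drop i l = ⟦ dropᴾ ⟧ α (i ∷ l ∷ [])

    drop-suc : ∀ i l → drop (suc i) l ≡ drop i (⟦ tailE (var (# 0)) ⟧₁ α l)
    drop-suc zero    l = refl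
    drop-suc (suc i) l = cong (⟦ tailE (var (# 0)) ⟧₁ α) (drop-suc i l)

  lookupᴾ-correct : ∀ {n} (xs : Vec ℕ n) i → ⟦ lookupᴾ ⟧ α (toℕ i ∷ encodeVec xs ∷ []) ≡ lookupV xs i
  lookupᴾ-correct (x ∷ xs) fz     = fstℕ-⟨,⟩ α x (encodeVec xs)
  lookupᴾ-correct (x ∷ xs) (fs i) = begin
    headL (drop (suc (toℕ i)) (encodeVec (x ∷ xs))) ≡⟨ cong headL (drop-suc (toℕ i) _) ⟩
    headL (drop (toℕ i) (sndℕ α ⟨ x , encodeVec xs ⟩)) ≡⟨ cong (headL ∘′ drop (toℕ i)) (sndℕ-⟨,⟩ α x _) ⟩
    headL (drop (toℕ i) (encodeVec xs))             ≡⟨ lookupᴾ-correct xs i ⟩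
    lookupV xs i                                    ∎
    where
    headL = ⟦ headE (var (# 0)) ⟧₁ α

-- Configurations of a machine evaluating codes: evaluate a code, or a vector of codes, on an
-- encoded argument vector, or return a value; each carries a stack of pending frames, 0 being empty.
evalConf evalsConf : ℕ → ℕ → ℕ → ℕ
evalConf  c  xs K = ⟨ 0 , ⟨ c , ⟨ xs , K ⟩ ⟩ ⟩
evalsConf gs xs K = ⟨ 1 , ⟨ gs , ⟨ xs , K ⟩ ⟩ ⟩

retConf push : ℕ → ℕ → ℕ
retConf v K  = ⟨ 2 , ⟨ v , K ⟩ ⟩
push frame K = suc ⟨ frame , K ⟩

-- What to do with a returned value v: evaluate the remaining argument codes gs and cons v onto
-- their values; cons y onto the vector v; apply f to the arguments v; evaluate the step g of a
-- primitive recursion at (k , v , xs); in a search for the least zero of f, stop at k if v = 0.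
argsFrame : ℕ → ℕ → ℕ
argsFrame gs xs = ⟨ 0 , ⟨ gs , xs ⟩ ⟩

consFrame applyFrame : ℕ → ℕ
consFrame y  = ⟨ 1 , y ⟩
applyFrame f = ⟨ 2 , f ⟩

recFrame muFrame : ℕ → ℕ → ℕ → ℕ
recFrame g k xs = ⟨ 3 , ⟨ g , ⟨ k , xs ⟩ ⟩ ⟩
muFrame  f k xs = ⟨ 4 , ⟨ f , ⟨ k , xs ⟩ ⟩ ⟩

evalConfE evalsConfE : ∀ {n} → Prog n → Prog n → Prog n → Prog n
evalConfE  c  xs K = pairE (litE 0) (pairE c (pairE xs K))
evalsConfE gs xs K = pairE (litE 1) (pairE gs (pairE xs K))

retConfE pushE argsFrameE : ∀ {n} → Prog n → Prog n → Prog n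
retConfE v K     = pairE (litE 2) (pairE v K)
pushE            = consE
argsFrameE gs xs = pairE (litE 0) (pairE gs xs)

consFrameE applyFrameE : ∀ {n} → Prog n → Prog n
consFrameE  = pairE (litE 1)
applyFrameE = pairE (litE 2)

recFrameE muFrameE : ∀ {n} → Prog n → Prog n → Prog n → Prog n
recFrameE g k xs = pairE (litE 3) (pairE g (pairE k xs))
muFrameE  f k xs = pairE (litE 4) (pairE f (pairE k xs))

-- The cases follow the tags 0 … 6 that ⌜_⌝ gives to zer, sucC, prj, orc, comp, prec and mu.
evalCaseᴾ : Prog 9
evalCaseᴾ = caseE tag
  ( retConfE zeroᴾ stack
  ∷ retConfE (call₁ sucᴾ (headE args)) stack
  ∷ retConfE (call₂ lookupᴾ (sndE body) args) stack
  ∷ retConfE (call₁ oracleᴾ (call₁ sucᴾ (headE args))) stack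
  ∷ evalsConfE (sndE body) args (pushE (applyFrameE (fstE body)) stack)
  ∷ ifZeroE (headE args)
      (evalConfE (fstE body) (tailE args) stack)
      (evalConfE code (consE k (tailE args)) (pushE (recFrameE (sndE body) k (tailE args)) stack))
  ∷ evalConfE body (consE zeroᴾ args) (pushE (muFrameE body zeroᴾ args) stack)
  ∷ []) zeroᴾ
  where
  tag body args stack code k : Prog 9
  tag   = var (# 0)
  body  = var (# 1)
  args  = var (# 2)
  stack = var (# 3)
  code  = var (# 4)
  k     = predE (headE args)

evalsCaseᴾ : Prog 7
evalsCaseᴾ = ifZeroE codes (retConfE zeroᴾ stack)
  (evalConfE (headE codes) args (pushE (argsFrameE (tailE codes) args) stack))
  where
  args stack codes : Prog 7
  args  = var (# 0)
  stack = var (# 1)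
  codes = var (# 2)

frameCaseᴾ : Prog 9
frameCaseᴾ = caseE tag
  ( evalsConfE (fstE body) (sndE body) (pushE (consFrameE value) rest)
  ∷ retConfE (consE body value) rest
  ∷ evalConfE body value rest
  ∷ evalConfE f (consE k (consE value xs)) rest
  ∷ ifZeroE value (retConfE k rest)
      (evalConfE f (consE (call₁ sucᴾ k) xs) (pushE (muFrameE f (call₁ sucᴾ k) xs) rest))
  ∷ []) zeroᴾ
  where
  tag body rest value f k xs : Prog 9
  tag   = var (# 0)
  body  = var (# 1)
  rest  = var (# 3)
  value = var (# 4)
  f     = fstE body
  k     = fstE (sndE body)
  xs    = sndE (sndE body)

-- A return to the empty stack is a fixed point of the transition function: that is how the machine halts.
returnCaseᴾ : Prog 5
returnCaseᴾ = ifZeroE (var (# 1)) (var (# 4)) (unpairIn (predE (var (# 1))) (unpairIn (var (# 0)) frameCaseᴾ))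

evalStepᴾ evalsStepᴾ returnStepᴾ stepCaseᴾ haltCaseᴾ : Prog 3
evalStepᴾ   = unpairIn (var (# 1)) (unpairIn (var (# 1)) (unpairIn (var (# 2)) evalCaseᴾ))
evalsStepᴾ  = unpairIn (var (# 1)) (unpairIn (var (# 1)) evalsCaseᴾ)
returnStepᴾ = unpairIn (var (# 1)) returnCaseᴾ
stepCaseᴾ   = ifZeroE (var (# 0)) evalStepᴾ (ifZeroE (predE (var (# 0))) evalsStepᴾ returnStepᴾ)
haltCaseᴾ   = ifZeroE (var (# 0)) oneᴾ (ifZeroE (predE (var (# 0))) oneᴾ (sndE (var (# 1))))

stepᴾ haltFlagᴾ : Prog 1
stepᴾ     = unpairIn (var (# 0)) stepCaseᴾ
haltFlagᴾ = unpairIn (var (# 0)) haltCaseᴾ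

module Machine (β : Baire) where
  opaque
    step : ℕ → ℕ
    step = ⟦ stepᴾ ⟧₁ β

  haltFlag : ℕ → ℕ
  haltFlag = ⟦ haltFlagᴾ ⟧₁ β

  ⟦⟧-fst∷snd-⟨,⟩ : ∀ {n} (P : Prog (suc (suc n))) xs a b →
    ⟦ P ⟧ β (fstℕ β ⟨ a , b ⟩ ∷ sndℕ β ⟨ a , b ⟩ ∷ xs) ≡ ⟦ P ⟧ β (a ∷ b ∷ xs)
  ⟦⟧-fst∷snd-⟨,⟩ P xs a b = cong₂ (λ u v → ⟦ P ⟧ β (u ∷ v ∷ xs)) (fstℕ-⟨,⟩ β a b) (sndℕ-⟨,⟩ β a b)

  evalContext : ℕ → ℕ → ℕ → ℕ → Vec ℕ 7
  evalContext t b xs K = xs ∷ K ∷ ⟨ t , b ⟩ ∷ ⟨ xs , K ⟩ ∷ 0 ∷ ⟨ ⟨ t , b ⟩ , ⟨ xs , K ⟩ ⟩ ∷ evalConf ⟨ t , b ⟩ xs K ∷ []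

  evalsContext : ℕ → ℕ → ℕ → Vec ℕ 7
  evalsContext gs xs K = xs ∷ K ∷ gs ∷ ⟨ xs , K ⟩ ∷ 1 ∷ ⟨ gs , ⟨ xs , K ⟩ ⟩ ∷ evalsConf gs xs K ∷ []

  returnContext : ℕ → ℕ → ℕ → Vec ℕ 7
  returnContext frame K v = frame ∷ K ∷ v ∷ push frame K ∷ 2 ∷ ⟨ v , push frame K ⟩ ∷ retConf v (push frame K) ∷ []

  haltFlag-retConf : ∀ v → haltFlag (retConf v 0) ≡ 0
  haltFlag-retConf v = trans (⟦⟧-fst∷snd-⟨,⟩ haltCaseᴾ (retConf v 0 ∷ []) 2 ⟨ v , 0 ⟩) (sndℕ-⟨,⟩ β v 0)

  opaque
    unfolding step

    step-def : ∀ c → step c ≡ ⟦ stepᴾ ⟧₁ β c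
    step-def c = refl

    step-halted : ∀ c → haltFlag c ≡ 0 → step c ≡ c
    step-halted c h with fstℕ β c | sndℕ β (sndℕ β c)
    step-halted c () | zero        | _
    step-halted c () | suc zero    | _
    step-halted c h  | suc (suc t) | zero  = refl
    step-halted c () | suc (suc t) | suc _

    step-evalConf : ∀ t b xs K → step (evalConf ⟨ t , b ⟩ xs K) ≡ ⟦ evalCaseᴾ ⟧ β (t ∷ b ∷ evalContext t b xs K)
    step-evalConf t b xs K =
      trans (⟦⟧-fst∷snd-⟨,⟩ stepCaseᴾ (c ∷ []) 0 ⟨ ⟨ t , b ⟩ , ⟨ xs , K ⟩ ⟩)
      (trans (⟦⟧-fst∷snd-⟨,⟩ (unpairIn (var (# 1)) (unpairIn (var (# 2)) evalCaseᴾ))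
                            (0 ∷ ⟨ ⟨ t , b ⟩ , ⟨ xs , K ⟩ ⟩ ∷ c ∷ []) ⟨ t , b ⟩ ⟨ xs , K ⟩)
      (trans (⟦⟧-fst∷snd-⟨,⟩ (unpairIn (var (# 2)) evalCaseᴾ)
                            (⟨ t , b ⟩ ∷ ⟨ xs , K ⟩ ∷ 0 ∷ ⟨ ⟨ t , b ⟩ , ⟨ xs , K ⟩ ⟩ ∷ c ∷ []) xs K)
             (⟦⟧-fst∷snd-⟨,⟩ evalCaseᴾ (evalContext t b xs K) t b)))
      where
      c : ℕ
      c = evalConf ⟨ t , b ⟩ xs K

    step-evalsConf : ∀ gs xs K → step (evalsConf gs xs K) ≡ ⟦ evalsCaseᴾ ⟧ β (evalsContext gs xs K)
    step-evalsConf gs xs K =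
      trans (⟦⟧-fst∷snd-⟨,⟩ stepCaseᴾ (c ∷ []) 1 ⟨ gs , ⟨ xs , K ⟩ ⟩)
      (trans (⟦⟧-fst∷snd-⟨,⟩ (unpairIn (var (# 1)) evalsCaseᴾ) (1 ∷ ⟨ gs , ⟨ xs , K ⟩ ⟩ ∷ c ∷ []) gs ⟨ xs , K ⟩)
             (⟦⟧-fst∷snd-⟨,⟩ evalsCaseᴾ (gs ∷ ⟨ xs , K ⟩ ∷ 1 ∷ ⟨ gs , ⟨ xs , K ⟩ ⟩ ∷ c ∷ []) xs K))
      where
      c : ℕ
      c = evalsConf gs xs K

    step-retConf-push : ∀ t b K v →
      step (retConf v (push ⟨ t , b ⟩ K)) ≡ ⟦ frameCaseᴾ ⟧ β (t ∷ b ∷ returnContext ⟨ t , b ⟩ K v)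
    step-retConf-push t b K v =
      trans (⟦⟧-fst∷snd-⟨,⟩ stepCaseᴾ (c ∷ []) 2 ⟨ v , push ⟨ t , b ⟩ K ⟩)
      (trans (⟦⟧-fst∷snd-⟨,⟩ returnCaseᴾ (2 ∷ ⟨ v , push ⟨ t , b ⟩ K ⟩ ∷ c ∷ []) v (push ⟨ t , b ⟩ K))
      (trans (⟦⟧-fst∷snd-⟨,⟩ (unpairIn (var (# 0)) frameCaseᴾ)
                            (v ∷ push ⟨ t , b ⟩ K ∷ 2 ∷ ⟨ v , push ⟨ t , b ⟩ K ⟩ ∷ c ∷ []) ⟨ t , b ⟩ K)
             (⟦⟧-fst∷snd-⟨,⟩ frameCaseᴾ (returnContext ⟨ t , b ⟩ K v) t b)))
      where
      c : ℕ
      c = retConf v (push ⟨ t , b ⟩ K)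

  step-zer : ∀ {n} xs K → step (evalConf (⌜ zer {n} ⌝) xs K) ≡ retConf 0 K
  step-zer {n} xs K = step-evalConf 0 n xs K

  step-suc : ∀ x K → step (evalConf ⌜ sucC ⌝ (encodeVec (x ∷ [])) K) ≡ retConf (suc x) K
  step-suc x K = trans (step-evalConf 1 0 (encodeVec (x ∷ [])) K) (cong (λ u → retConf (suc u) K) (fstℕ-⟨,⟩ β x 0))

  step-prj : ∀ {n} (i : Fin n) xs K → step (evalConf ⌜ prj i ⌝ (encodeVec xs) K) ≡ retConf (lookupV xs i) K
  step-prj {n} i xs K = trans (step-evalConf 2 ⟨ n , toℕ i ⟩ (encodeVec xs) K) (cong (λ u → retConf u K)
    (trans (cong (λ j → ⟦ lookupᴾ ⟧ β (j ∷ encodeVec xs ∷ [])) (sndℕ-⟨,⟩ β n (toℕ i))) (lookupᴾ-correct β xs i)))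

  step-orc : ∀ x K → step (evalConf ⌜ orc ⌝ (encodeVec (x ∷ [])) K) ≡ retConf (β (suc x)) K
  step-orc x K = trans (step-evalConf 3 0 (encodeVec (x ∷ [])) K) (cong (λ u → retConf (β (suc u)) K) (fstℕ-⟨,⟩ β x 0))

  step-comp : ∀ {m n} (f : Code m) (gs : Vec (Code n) m) xs K →
    step (evalConf ⌜ comp f gs ⌝ xs K) ≡ evalsConf ⌜ gs ⌝V xs (push (applyFrame ⌜ f ⌝) K)
  step-comp f gs xs K = trans (step-evalConf 4 ⟨ ⌜ f ⌝ , ⌜ gs ⌝V ⟩ xs K)
    (cong₂ (λ u v → evalsConf v xs (push (applyFrame u) K)) (fstℕ-⟨,⟩ β ⌜ f ⌝ ⌜ gs ⌝V) (sndℕ-⟨,⟩ β ⌜ f ⌝ ⌜ gs ⌝V))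

  step-prec-zero : ∀ {n} (f : Code n) (g : Code (suc (suc n))) (xs : Vec ℕ n) K →
    step (evalConf ⌜ prec f g ⌝ (encodeVec (0 ∷ xs)) K) ≡ evalConf ⌜ f ⌝ (encodeVec xs) K
  step-prec-zero f g xs K = trans (step-evalConf 5 ⟨ ⌜ f ⌝ , ⌜ g ⌝ ⟩ (encodeVec (0 ∷ xs)) K) reduce
    where
    reduce : ⟦ evalCaseᴾ ⟧ β (5 ∷ ⟨ ⌜ f ⌝ , ⌜ g ⌝ ⟩ ∷ evalContext 5 ⟨ ⌜ f ⌝ , ⌜ g ⌝ ⟩ (encodeVec (0 ∷ xs)) K)
           ≡ evalConf ⌜ f ⌝ (encodeVec xs) K
    reduce rewrite fstℕ-⟨,⟩ β 0 (encodeVec xs) | sndℕ-⟨,⟩ β 0 (encodeVec xs) | fstℕ-⟨,⟩ β ⌜ f ⌝ ⌜ g ⌝ = refl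

  step-prec-suc : ∀ {n} (f : Code n) (g : Code (suc (suc n))) k (xs : Vec ℕ n) K →
    step (evalConf ⌜ prec f g ⌝ (encodeVec (suc k ∷ xs)) K) ≡
    evalConf ⌜ prec f g ⌝ (encodeVec (k ∷ xs)) (push (recFrame ⌜ g ⌝ k (encodeVec xs)) K)
  step-prec-suc f g k xs K = trans (step-evalConf 5 ⟨ ⌜ f ⌝ , ⌜ g ⌝ ⟩ (encodeVec (suc k ∷ xs)) K) reduce
    where
    reduce : ⟦ evalCaseᴾ ⟧ β (5 ∷ ⟨ ⌜ f ⌝ , ⌜ g ⌝ ⟩ ∷ evalContext 5 ⟨ ⌜ f ⌝ , ⌜ g ⌝ ⟩ (encodeVec (suc k ∷ xs)) K)
           ≡ evalConf ⌜ prec f g ⌝ (encodeVec (k ∷ xs)) (push (recFrame ⌜ g ⌝ k (encodeVec xs)) K)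
    reduce rewrite fstℕ-⟨,⟩ β (suc k) (encodeVec xs) | sndℕ-⟨,⟩ β (suc k) (encodeVec xs)
                 | sndℕ-⟨,⟩ β ⌜ f ⌝ ⌜ g ⌝ = refl

  step-mu : ∀ {n} (f : Code (suc n)) (xs : Vec ℕ n) K →
    step (evalConf ⌜ mu f ⌝ (encodeVec xs) K) ≡
    evalConf ⌜ f ⌝ (encodeVec (0 ∷ xs)) (push (muFrame ⌜ f ⌝ 0 (encodeVec xs)) K)
  step-mu f xs K = step-evalConf 6 ⌜ f ⌝ (encodeVec xs) K

  step-evals-[] : ∀ {n} xs K → step (evalsConf (⌜_⌝V {n} []) xs K) ≡ retConf 0 K
  step-evals-[] xs K = step-evalsConf 0 xs K

  step-evals-∷ : ∀ {n m} (g : Code n) (gs : Vec (Code n) m) xs K →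
    step (evalsConf ⌜ g ∷ gs ⌝V xs K) ≡ evalConf ⌜ g ⌝ xs (push (argsFrame ⌜ gs ⌝V xs) K)
  step-evals-∷ g gs xs K = trans (step-evalsConf ⌜ g ∷ gs ⌝V xs K)
    (cong₂ (λ u v → evalConf u xs (push (argsFrame v xs) K)) (fstℕ-⟨,⟩ β ⌜ g ⌝ ⌜ gs ⌝V) (sndℕ-⟨,⟩ β ⌜ g ⌝ ⌜ gs ⌝V))

  step-argsFrame : ∀ v gs xs K → step (retConf v (push (argsFrame gs xs) K)) ≡ evalsConf gs xs (push (consFrame v) K)
  step-argsFrame v gs xs K = trans (step-retConf-push 0 ⟨ gs , xs ⟩ K v)
    (cong₂ (λ u w → evalsConf u w (push (consFrame v) K)) (fstℕ-⟨,⟩ β gs xs) (sndℕ-⟨,⟩ β gs xs))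

  step-consFrame : ∀ ys y K → step (retConf ys (push (consFrame y) K)) ≡ retConf (suc ⟨ y , ys ⟩) K
  step-consFrame ys y K = step-retConf-push 1 y K ys

  step-applyFrame : ∀ v f K → step (retConf v (push (applyFrame f) K)) ≡ evalConf f v K
  step-applyFrame v f K = step-retConf-push 2 f K v

  step-recFrame : ∀ z g k xs K → step (retConf z (push (recFrame g k xs) K)) ≡ evalConf g (suc ⟨ k , suc ⟨ z , xs ⟩ ⟩) K
  step-recFrame z g k xs K = trans (step-retConf-push 3 ⟨ g , ⟨ k , xs ⟩ ⟩ K z) reduce
    where
    reduce : ⟦ frameCaseᴾ ⟧ β (3 ∷ ⟨ g , ⟨ k , xs ⟩ ⟩ ∷ returnContext (recFrame g k xs) K z)
           ≡ evalConf g (suc ⟨ k , suc ⟨ z , xs ⟩ ⟩) K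
    reduce rewrite fstℕ-⟨,⟩ β g ⟨ k , xs ⟩ | sndℕ-⟨,⟩ β g ⟨ k , xs ⟩ | fstℕ-⟨,⟩ β k xs | sndℕ-⟨,⟩ β k xs = refl

  step-muFrame-zero : ∀ f k xs K → step (retConf 0 (push (muFrame f k xs) K)) ≡ retConf k K
  step-muFrame-zero f k xs K = trans (step-retConf-push 4 ⟨ f , ⟨ k , xs ⟩ ⟩ K 0) reduce
    where
    reduce : ⟦ frameCaseᴾ ⟧ β (4 ∷ ⟨ f , ⟨ k , xs ⟩ ⟩ ∷ returnContext (muFrame f k xs) K 0) ≡ retConf k K
    reduce rewrite sndℕ-⟨,⟩ β f ⟨ k , xs ⟩ | fstℕ-⟨,⟩ β k xs = refl

  step-muFrame-suc : ∀ j f k xs K → step (retConf (suc j) (push (muFrame f k xs) K)) ≡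
    evalConf f (suc ⟨ suc k , xs ⟩) (push (muFrame f (suc k) xs) K)
  step-muFrame-suc j f k xs K = trans (step-retConf-push 4 ⟨ f , ⟨ k , xs ⟩ ⟩ K (suc j)) reduce
    where
    reduce : ⟦ frameCaseᴾ ⟧ β (4 ∷ ⟨ f , ⟨ k , xs ⟩ ⟩ ∷ returnContext (muFrame f k xs) K (suc j))
           ≡ evalConf f (suc ⟨ suc k , xs ⟩) (push (muFrame f (suc k) xs) K)
    reduce rewrite fstℕ-⟨,⟩ β f ⟨ k , xs ⟩ | sndℕ-⟨,⟩ β f ⟨ k , xs ⟩ | fstℕ-⟨,⟩ β k xs | sndℕ-⟨,⟩ β k xs = refl

module Simulation (e : ℕ) (q : Baire) where
  open Machine (e ⌢ q)

  Steps : ℕ → ℕ → Set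
  Steps = Star (λ a b → step a ≡ b)

  Steps⇒fold : ∀ {a b} → Steps a b → ∃ λ s → fold a step s ≡ b
  Steps⇒fold ε = 0 , refl
  Steps⇒fold {a} (refl ◅ steps) with Steps⇒fold steps
  ... | s , reaches = s + 1 , trans (fold-+ a step s) reaches

  mutual
    eval-steps : ∀ {n} {c : Code n} {xs y} → Eval q c xs y → ∀ K →
                 Steps (evalConf ⌜ c ⌝ (encodeVec xs) K) (retConf y K)
    eval-steps (ev-zer {n} {xs}) K = step-zer {n} (encodeVec xs) K ◅ ε
    eval-steps (ev-suc {x})       K = step-suc x K ◅ ε
    eval-steps (ev-prj {i = i} {xs}) K = step-prj i xs K ◅ ε
    eval-steps (ev-orc {x})       K = step-orc x K ◅ ε
    eval-steps (ev-comp {f = f} {gs} {xs} {ys} dgs df) K =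
      step-comp f gs (encodeVec xs) K ◅ evals-steps dgs (push (applyFrame ⌜ f ⌝) K) ◅◅
      step-applyFrame (encodeVec ys) ⌜ f ⌝ K ◅ eval-steps df K
    eval-steps (ev-prec0 {f = f} {g} {xs} d) K = step-prec-zero f g xs K ◅ eval-steps d K
    eval-steps (ev-precS {f = f} {g} {k} {xs} {z} d₁ d₂) K =
      step-prec-suc f g k xs K ◅ eval-steps d₁ (push (recFrame ⌜ g ⌝ k (encodeVec xs)) K) ◅◅
      step-recFrame z ⌜ g ⌝ k (encodeVec xs) K ◅ eval-steps d₂ K
    eval-steps (ev-mu {f = f} {xs} {k} d₀ below) K =
      step-mu f xs K ◅ search-steps d₀ below k 0 (+-identityʳ k) K

    search-steps : ∀ {n} {f : Code (suc n)} {xs : Vec ℕ n} {k} → Eval q f (k ∷ xs) 0 →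
      (∀ m → m < k → ∃ λ j → Eval q f (m ∷ xs) (suc j)) → ∀ d m → d + m ≡ k → ∀ K →
      Steps (evalConf ⌜ f ⌝ (encodeVec (m ∷ xs)) (push (muFrame ⌜ f ⌝ m (encodeVec xs)) K)) (retConf k K)
    search-steps {f = f} {xs} {k} d₀ below zero .k refl K =
      eval-steps d₀ (push (muFrame ⌜ f ⌝ k (encodeVec xs)) K) ◅◅ step-muFrame-zero ⌜ f ⌝ k (encodeVec xs) K ◅ ε
    search-steps {f = f} {xs} {k} d₀ below (suc d) m d+m≡k K =
      eval-steps (proj₂ (below m m<k)) (push (muFrame ⌜ f ⌝ m (encodeVec xs)) K) ◅◅
      step-muFrame-suc (proj₁ (below m m<k)) ⌜ f ⌝ m (encodeVec xs) K ◅
      search-steps d₀ below d (suc m) (trans (+-suc d m) d+m≡k) K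
      where
      m<k : m < k
      m<k = subst (m <_) d+m≡k (s≤s (m≤n+m m d))

    evals-steps : ∀ {n m} {gs : Vec (Code n) m} {xs : Vec ℕ n} {ys} → EvalV q gs xs ys → ∀ K →
                  Steps (evalsConf ⌜ gs ⌝V (encodeVec xs) K) (retConf (encodeVec ys) K)
    evals-steps {n} (evv-[] {xs}) K = step-evals-[] {n} (encodeVec xs) K ◅ ε
    evals-steps (evv-∷ {g = g} {gs} {xs} {y} {ys} d ds) K =
      step-evals-∷ g gs (encodeVec xs) K ◅ eval-steps d (push (argsFrame ⌜ gs ⌝V (encodeVec xs)) K) ◅◅
      step-argsFrame y ⌜ gs ⌝V (encodeVec xs) K ◅ evals-steps ds (push (consFrame y) K) ◅◅
      step-consFrame (encodeVec ys) y K ◅ ε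

Least : (ℕ → Set) → ℕ → Set
Least P m = P m × (∀ j → j < m → ¬ P j)

Least-≤ : ∀ {P m s} → Least P m → P s → m ≤ s
Least-≤ (_ , below) Ps = ≮⇒≥ (λ s<m → below _ s<m Ps)

least-witness : ∀ {P : ℕ → Set} → Decidable P → ∀ s → P s → ∃ (Least P)
least-witness {P} P? s Ps = search s 0 (λ _ ()) (subst P (sym (+-identityʳ s)) Ps)
  where
  search : ∀ d m → (∀ j → j < m → ¬ P j) → P (d + m) → ∃ (Least P)
  search zero    m below Pm = m , Pm , below
  search (suc d) m below P[1+d+m] with P? m
  ... | yes Pm = m , Pm , below
  ... | no ¬Pm = search d (suc m) below′ (subst P (sym (+-suc d m)) P[1+d+m])
    where
    below′ : ∀ j → j < suc m → ¬ P j
    below′ j j<1+m with m<1+n⇒m<n∨m≡n j<1+m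
    ... | inj₁ j<m  = below j j<m
    ... | inj₂ refl = ¬Pm

mu-least : ∀ {α n} (P : Prog (suc n)) {xs k} → ⟦ P ⟧ α (k ∷ xs) ≡ 0 →
           (∀ j → j < k → ⟦ P ⟧ α (j ∷ xs) ≢ 0) → Eval α (mu (compile P)) xs k
mu-least {α} P {xs} P[k]≡0 P[j]≢0 = ev-mu (compile-computes P P[k]≡0) λ j j<k →
  pred (⟦ P ⟧ α (j ∷ xs)) ,
  compile-computes P (sym (suc-pred (⟦ P ⟧ α (j ∷ xs)) {{≢-nonZero (P[j]≢0 j j<k)}}))

initConfᴾ outputᴾ : Prog 1
initConfᴾ = evalConfE (call₁ oracleᴾ zeroᴾ) (consE (var (# 0)) zeroᴾ) zeroᴾ
outputᴾ   = fstE (sndE (var (# 0)))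

runᴾ haltedAfterᴾ outputAfterᴾ : Prog 2
runᴾ         = recᴾ initConfᴾ (call₁ stepᴾ (var (# 1)))
haltedAfterᴾ = call₁ haltFlagᴾ runᴾ
outputAfterᴾ = call₁ outputᴾ runᴾ

-- The machine runs on the oracle ⌜ e ⌝ ⌢ q itself: it reads the code at position 0, and answers
-- the code's query at x with position suc x (see the oracle case of evalCaseᴾ).
universalC : Code 1
universalC = comp (compile outputAfterᴾ) (mu (compile haltedAfterᴾ) ∷ prj fz ∷ [])

module _ (e : Functional) (q : Baire) where
  open Machine (⌜ e ⌝ ⌢ q)
  open Simulation ⌜ e ⌝ q

  private
    β : Baire
    β = ⌜ e ⌝ ⌢ q

    run : ℕ → ℕ → ℕ
    run n s = ⟦ runᴾ ⟧ β (s ∷ n ∷ [])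

    initConf : ℕ → ℕ
    initConf n = evalConf ⌜ e ⌝ (encodeVec (n ∷ [])) 0

    run-fold : ∀ n s → run n s ≡ fold (initConf n) step s
    run-fold n zero    = refl
    run-fold n (suc s) = trans (sym (step-def (run n s))) (cong step (run-fold n s))

    fold-halted : ∀ {c} → haltFlag c ≡ 0 → ∀ d → fold c step d ≡ c
    fold-halted h zero    = refl
    fold-halted h (suc d) = trans (cong step (fold-halted h d)) (step-halted _ h)

    output-retConf : ∀ v K → ⟦ outputᴾ ⟧₁ β (retConf v K) ≡ v
    output-retConf v K = trans (cong (fstℕ β) (sndℕ-⟨,⟩ β 2 ⟨ v , K ⟩)) (fstℕ-⟨,⟩ β v K)

    Halted : ℕ → ℕ → Set
    Halted n s = haltFlag (run n s) ≡ 0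

    halted-at : ∀ n y s → fold (initConf n) step s ≡ retConf y 0 → Halted n s
    halted-at n y s reaches = trans (cong haltFlag (trans (run-fold n s) reaches)) (haltFlag-retConf y)

    output-at-first-halt : ∀ n y s s₀ → fold (initConf n) step s ≡ retConf y 0 → Least (Halted n) s₀ →
                           run n s₀ ≡ retConf y 0
    output-at-first-halt n y s s₀ reaches least@(halted₀ , _) = begin
      run n s₀                                    ≡⟨ sym (fold-halted halted₀ (s ∸ s₀)) ⟩
      fold (run n s₀) step (s ∸ s₀)               ≡⟨ cong (λ c → fold c step (s ∸ s₀)) (run-fold n s₀) ⟩
      fold (fold (initConf n) step s₀) step (s ∸ s₀) ≡⟨ sym (fold-+ (initConf n) step (s ∸ s₀)) ⟩
      fold (initConf n) step (s ∸ s₀ + s₀)        ≡⟨ cong (fold (initConf n) step) (m∸n+n≡m (Least-≤ least (halted-at n y s reaches))) ⟩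
      fold (initConf n) step s                    ≡⟨ reaches ⟩
      retConf y 0                                 ∎

    halting-time-eval : ∀ n s₀ → Least (Halted n) s₀ → Eval β (mu (compile haltedAfterᴾ)) (n ∷ []) s₀
    halting-time-eval n s₀ (halted₀ , running) = mu-least haltedAfterᴾ halted₀ running

    output-eval : ∀ n s₀ y → run n s₀ ≡ retConf y 0 → Eval β (compile outputAfterᴾ) (s₀ ∷ n ∷ []) y
    output-eval n s₀ y returns =
      compile-computes outputAfterᴾ (trans (cong (⟦ outputᴾ ⟧₁ β) returns) (output-retConf y 0))

  universalC-correct : ∀ p → e ⟦ q ⟧≡ p → universalC ⟦ ⌜ e ⌝ ⌢ q ⟧≡ p
  universalC-correct p e⟦q⟧ n =
    let s  , reaches = Steps⇒fold (eval-steps (e⟦q⟧ n) 0)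
        s₀ , least   = least-witness (λ j → haltFlag (run n j) ≟ 0) s (halted-at n (p n) s reaches)
    in ev-comp (evv-∷ (halting-time-eval n s₀ least) (evv-∷ ev-prj evv-[]))
               (output-eval n s₀ (p n) (output-at-first-halt n (p n) s s₀ reaches least))

mutual
  Eval-resp-≈B : ∀ {α β} → α ≈B β → ∀ {n} {c : Code n} {xs y} → Eval α c xs y → Eval β c xs y
  Eval-resp-≈B α≈β ev-zer          = ev-zer
  Eval-resp-≈B α≈β ev-suc          = ev-suc
  Eval-resp-≈B α≈β ev-prj          = ev-prj
  Eval-resp-≈B {β = β} α≈β (ev-orc {x}) = subst (Eval β orc (x ∷ [])) (sym (α≈β x)) ev-orc
  Eval-resp-≈B α≈β (ev-comp ds d)  = ev-comp (EvalV-resp-≈B α≈β ds) (Eval-resp-≈B α≈β d)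
  Eval-resp-≈B α≈β (ev-prec0 d)    = ev-prec0 (Eval-resp-≈B α≈β d)
  Eval-resp-≈B α≈β (ev-precS d d′) = ev-precS (Eval-resp-≈B α≈β d) (Eval-resp-≈B α≈β d′)
  Eval-resp-≈B α≈β (ev-mu d below) =
    ev-mu (Eval-resp-≈B α≈β d) (λ m m<k → proj₁ (below m m<k) , Eval-resp-≈B α≈β (proj₂ (below m m<k)))

  EvalV-resp-≈B : ∀ {α β} → α ≈B β → ∀ {n m} {gs : Vec (Code n) m} {xs ys} → EvalV α gs xs ys → EvalV β gs xs ys
  EvalV-resp-≈B α≈β evv-[]        = evv-[]
  EvalV-resp-≈B α≈β (evv-∷ d ds) = evv-∷ (Eval-resp-≈B α≈β d) (EvalV-resp-≈B α≈β ds)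

⟦⟧≡-resp-≈B : ∀ {α β e p} → α ≈B β → e ⟦ α ⟧≡ p → e ⟦ β ⟧≡ p
⟦⟧≡-resp-≈B α≈β e⟦α⟧ n = Eval-resp-≈B α≈β (e⟦α⟧ n)

mutual
  substOracle : ∀ {n} → Code n → Code 1 → Code n
  substOracle zer         d = zer
  substOracle sucC        d = sucC
  substOracle (prj i)     d = prj i
  substOracle orc         d = d
  substOracle (comp f gs) d = comp (substOracle f d) (substOracle* gs d)
  substOracle (prec f g)  d = prec (substOracle f d) (substOracle g d)
  substOracle (mu f)      d = mu (substOracle f d)

  substOracle* : ∀ {n m} → Vec (Code n) m → Code 1 → Vec (Code n) m
  substOracle* []       d = []
  substOracle* (g ∷ gs) d = substOracle g d ∷ substOracle* gs d

mutual
  substOracle-correct : ∀ {α β d} → d ⟦ α ⟧≡ β → ∀ {n} {c : Code n} {xs y} →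
                        Eval β c xs y → Eval α (substOracle c d) xs y
  substOracle-correct d⟦α⟧ ev-zer          = ev-zer
  substOracle-correct d⟦α⟧ ev-suc          = ev-suc
  substOracle-correct d⟦α⟧ ev-prj          = ev-prj
  substOracle-correct d⟦α⟧ (ev-orc {x})    = d⟦α⟧ x
  substOracle-correct d⟦α⟧ (ev-comp ds d)  = ev-comp (substOracle*-correct d⟦α⟧ ds) (substOracle-correct d⟦α⟧ d)
  substOracle-correct d⟦α⟧ (ev-prec0 d)    = ev-prec0 (substOracle-correct d⟦α⟧ d)
  substOracle-correct d⟦α⟧ (ev-precS d d′) = ev-precS (substOracle-correct d⟦α⟧ d) (substOracle-correct d⟦α⟧ d′)
  substOracle-correct d⟦α⟧ (ev-mu d below) = ev-mu (substOracle-correct d⟦α⟧ d)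
    (λ m m<k → proj₁ (below m m<k) , substOracle-correct d⟦α⟧ (proj₂ (below m m<k)))

  substOracle*-correct : ∀ {α β d} → d ⟦ α ⟧≡ β → ∀ {n m} {gs : Vec (Code n) m} {xs ys} →
                         EvalV β gs xs ys → EvalV α (substOracle* gs d) xs ys
  substOracle*-correct d⟦α⟧ evv-[]        = evv-[]
  substOracle*-correct d⟦α⟧ (evv-∷ d ds) = evv-∷ (substOracle-correct d⟦α⟧ d) (substOracle*-correct d⟦α⟧ ds)

module _ (α : Baire) where
  private
    double = ⟦ doubleᴾ ⟧₁ α

  ⊕-double : ∀ (p q : Baire) n → (p ⊕ q) (double n) ≡ p n
  ⊕-double p q zero    = refl
  ⊕-double p q (suc n) = ⊕-double (p ∘ suc) (q ∘ suc) n

  ⊕-suc-double : ∀ (p q : Baire) n → (p ⊕ q) (suc (double n)) ≡ q n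
  ⊕-suc-double p q zero    = refl
  ⊕-suc-double p q (suc n) = ⊕-suc-double (p ∘ suc) (q ∘ suc) n

  even-or-odd : ∀ n → ∃ λ m → n ≡ double m ⊎ n ≡ suc (double m)
  even-or-odd zero = 0 , inj₁ refl
  even-or-odd (suc n) with even-or-odd n
  ... | m , inj₁ n≡2m   = m , inj₂ (cong suc n≡2m)
  ... | m , inj₂ n≡2m+1 = suc m , inj₁ (cong suc n≡2m+1)

leftC : Code 1
leftC = comp orc (compile doubleᴾ ∷ [])

leftC-correct : ∀ p q → leftC ⟦ p ⊕ q ⟧≡ p
leftC-correct p q n = subst (Eval (p ⊕ q) leftC (n ∷ [])) (⊕-double (p ⊕ q) p q n)
  (ev-comp (evv-∷ (compile-correct doubleᴾ (p ⊕ q) (n ∷ [])) evv-[]) ev-orc)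

joinC : Code 1 → Code 1 → Code 1
joinC A B = comp (compile ifZeroᴾ) (compile parityᴾ ∷ comp A (compile halfᴾ ∷ []) ∷ comp B (compile halfᴾ ∷ []) ∷ [])

joinC-correct : ∀ {γ A B u v} → A ⟦ γ ⟧≡ u → B ⟦ γ ⟧≡ v → joinC A B ⟦ γ ⟧≡ (u ⊕ v)
joinC-correct {γ} {A} {B} {u} {v} A⟦γ⟧ B⟦γ⟧ n = subst (Eval γ (joinC A B) (n ∷ [])) (select-⊕ n)
  (ev-comp (evv-∷ (compile-correct parityᴾ γ (n ∷ []))
           (evv-∷ (ev-comp (evv-∷ (compile-correct halfᴾ γ (n ∷ [])) evv-[]) (A⟦γ⟧ (half n)))
           (evv-∷ (ev-comp (evv-∷ (compile-correct halfᴾ γ (n ∷ [])) evv-[]) (B⟦γ⟧ (half n))) evv-[])))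
    (compile-correct ifZeroᴾ γ (⟦ parityᴾ ⟧₁ γ n ∷ u (half n) ∷ v (half n) ∷ [])))
  where
  half = ⟦ halfᴾ ⟧₁ γ
  select-⊕ : ∀ n → ⟦ ifZeroᴾ ⟧ γ (⟦ parityᴾ ⟧₁ γ n ∷ u (half n) ∷ v (half n) ∷ []) ≡ (u ⊕ v) n
  select-⊕ n with even-or-odd γ n
  ... | m , inj₁ refl rewrite parity-even γ m | half-even γ m = sym (⊕-double γ u v m)
  ... | m , inj₂ refl rewrite parity-odd γ m  | half-odd γ m  = sym (⊕-suc-double γ u v m)

recomputeC : Code 1 → Code 1
recomputeC Φ = joinC leftC (substOracle Φ leftC)

recomputeC-correct : ∀ {Φ x r} q → Φ ⟦ x ⟧≡ r → recomputeC Φ ⟦ x ⊕ q ⟧≡ (x ⊕ r)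
recomputeC-correct {x = x} q Φ⟦x⟧ =
  joinC-correct (leftC-correct x q) (λ n → substOracle-correct (leftC-correct x q) (Φ⟦x⟧ n))

prependᴾ : ℕ → Prog 1
prependᴾ N = recᴾ (litE N) (call₁ oracleᴾ (var (# 0)))

litE-correct : ∀ {n} k α (xs : Vec ℕ n) → ⟦ litE k ⟧ α xs ≡ k
litE-correct zero    α xs = refl
litE-correct (suc k) α xs = cong suc (litE-correct k α xs)

prependᴾ-correct : ∀ N x → compile (prependᴾ N) ⟦ x ⟧≡ (N ⌢ x)
prependᴾ-correct N x zero    = compile-computes (prependᴾ N) (litE-correct N x [])
prependᴾ-correct N x (suc k) = compile-correct (prependᴾ N) x (suc k ∷ [])

tailC : Code 1 → Code 1
tailC Φ = comp Φ (comp sucC (prj fz ∷ []) ∷ [])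

tailC-correct : ∀ {Φ p r} → Φ ⟦ p ⟧≡ r → tailC Φ ⟦ p ⟧≡ (r ∘ suc)
tailC-correct Φ⟦p⟧ n = ev-comp (evv-∷ (ev-comp (evv-∷ ev-prj evv-[]) ev-suc) evv-[]) (Φ⟦p⟧ (suc n))

≤T⇒Singleton≤W : ∀ {c : MVF} {x p} → dom c x → x ≤T p → idOn (Singleton p) ≤W c
≤T⇒Singleton≤W {x = x} x∈dom (e , e⟦p⟧) =
  e , leftC , λ p′ p′≈p → x , ⟦⟧≡-resp-≈B (sym ∘ p′≈p) e⟦p⟧ , x∈dom , λ q _ → p′ , leftC-correct p′ q , λ _ → refl

module _ (p : Baire) where
  Succ≤WSingleton : idOn (Succ p) ≤W idOn (Singleton p)
  Succ≤WSingleton = universalC , leftC , reduce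
    where
    reduce : ∀ x → Succ p x → ∃ λ r → universalC ⟦ x ⟧≡ r × Singleton p r ×
               (∀ q → q ≈B r → ∃ λ s → leftC ⟦ x ⊕ q ⟧≡ s × s ≈B x)
    reduce x (e , q , x≈ , e⟦q⟧ , _) =
      p , ⟦⟧≡-resp-≈B (sym ∘ x≈) (universalC-correct e q p e⟦q⟧) , (λ _ → refl) ,
      λ q′ _ → x , leftC-correct x q′ , λ _ → refl

  Singleton≰WSucc : ¬ (idOn (Singleton p) ≤W idOn (Succ p))
  Singleton≰WSucc (Φ , _ , reduce) with reduce p (λ _ → refl)
  ... | r , Φ⟦p⟧ , (_ , q , r≈ , _ , q≰p) , _ =
    q≰p (tailC Φ , λ n → subst (Eval p (tailC Φ) (n ∷ [])) (r≈ (suc n)) (tailC-correct Φ⟦p⟧ n))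

  below-Singleton⇒≤WSucc : ∀ c → c <W idOn (Singleton p) → c ≤W idOn (Succ p)
  below-Singleton⇒≤WSucc c ((Φ , Ψ , reduce) , Singleton≰c) = compile (prependᴾ ⌜ Φ ⌝) , substOracle Ψ (recomputeC Φ) , reduce′
    where
    reduce′ : ∀ x → dom c x → ∃ λ r → compile (prependᴾ ⌜ Φ ⌝) ⟦ x ⟧≡ r × Succ p r ×
                (∀ q → q ≈B r → ∃ λ s → substOracle Ψ (recomputeC Φ) ⟦ x ⊕ q ⟧≡ s × val c x s)
    reduce′ x x∈dom with reduce x x∈dom
    ... | r , Φ⟦x⟧ , r≈p , answer with answer r (λ _ → refl)
    ...   | s , Ψ⟦x⊕r⟧ , s∈c[x] =
      ⌜ Φ ⌝ ⌢ x , prependᴾ-correct ⌜ Φ ⌝ x ,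
      (Φ , x , (λ _ → refl) , (λ n → subst (Eval x Φ (n ∷ [])) (r≈p n) (Φ⟦x⟧ n)) , Singleton≰c ∘ ≤T⇒Singleton≤W {c} x∈dom) ,
      λ q _ → s , (λ n → substOracle-correct (recomputeC-correct q Φ⟦x⟧) (Ψ⟦x⊕r⟧ n)) , s∈c[x]

mainTheorem13 : LEM → (p : Baire) →
    StrongMinimalCover (idOn (Singleton p)) (idOn (Succ p))
mainTheorem13 _ p = (Succ≤WSingleton p , Singleton≰WSucc p) , below-Singleton⇒≤WSucc p
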